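{- Let $n\ge 1$ and suppose $A=\{a_1,\dots,a_n\}$ is a set of integers with $1=a_1<a_2<\cdots<a_n$ such that $A\oplus A\supseteq[k,k+m-1]$ for some integers $k$ and $m\ge 1$. If $a_n\le m$, then $\mathcal{M}(n)\ge m-n$.
   Context: For a set $A$ of integers, $A\oplus A=\{a+b : a,b\in A,\ a\ne b\}$; $[x,y]$ denotes the set of integers $z$ with $x\le z\le y$, and $[k]=\{1,\dots,k\}$. All graphs are finite and simple, with $V(G)\cap E(G)=\emptyset$. For a graph $G$ with $n$ vertices and $m$ edges, an edge-magic labelling is a bijection $l:V(G)\cup E(G)\to[n+m]$ for which there is a constant $s$ such that $l(a)+l(b)+l(ab)=s$ for every edge $ab$; $G$ is edge-magic if it has such a labelling. $\mathcal{M}(n)$ is the maximum number of edges of an edge-magic graph with $n$ vertices. -}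

module Defs where

open import Data.Nat using (ℕ; suc; _+_; _<_; _≥_)
open import Data.Fin using (Fin; toℕ)
open import Data.Sum using (_⊎_; inj₁; inj₂)
open import Data.Product using (_×_; _,_; proj₁; proj₂; Σ; ∃)
open import Function.Bundles using (_⤖_; Bijection)
open import Function.Definitions using (Injective)
open import Relation.Binary.PropositionalEquality using (_≡_)

-- Edges are indexed by Fin m; edge e joins (proj₁ (ends e)) and (proj₂ (ends e)),
-- stored with the smaller endpoint first (no loops), and distinct indices give
-- distinct edges (no multi-edges).  V(G) = Fin n and E(G) = Fin m are disjoint,
-- and V ∪ E is modelled as the disjoint union Fin n ⊎ Fin m.
record Graph (n : ℕ) : Set where
  field
    m         : ℕ
    ends      : Fin m → Fin n × Fin n
    ordered   : ∀ e → toℕ (proj₁ (ends e)) < toℕ (proj₂ (ends e))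
    ends-inj  : Injective _≡_ _≡_ ends
open Graph public

-- An edge-magic labelling: a bijection  l : V(G) ∪ E(G) → [n + m]
-- (the label of x is toℕ (l x) + 1, so labels range over {1, …, n+m}),
-- together with a constant s with l(a) + l(b) + l(ab) = s for every edge ab.
label : ∀ {n} (G : Graph n) → (Fin n ⊎ Fin (m G)) ⤖ Fin (n + m G) →
        Fin n ⊎ Fin (m G) → ℕ
label G l x = suc (toℕ (Bijection.to l x))

IsEdgeMagicLabelling : ∀ {n} (G : Graph n) → (Fin n ⊎ Fin (m G)) ⤖ Fin (n + m G) → Set
IsEdgeMagicLabelling G l =
  Σ ℕ λ s → ∀ (e : Fin (m G)) →
    label G l (inj₁ (proj₁ (ends G e))) + label G l (inj₁ (proj₂ (ends G e)))
      + label G l (inj₂ e) ≡ s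

EdgeMagic : ∀ {n} → Graph n → Set
EdgeMagic {n} G = Σ ((Fin n ⊎ Fin (m G)) ⤖ Fin (n + m G)) λ l → IsEdgeMagicLabelling G l

-- "𝓜(n) ≥ t": 𝓜(n) is the maximum number of edges of an edge-magic graph on
-- n vertices (a maximum over a finite nonempty set of values: the edgeless graph
-- is edge-magic), so 𝓜(n) ≥ t holds iff some edge-magic graph on n vertices has
-- at least t edges.
𝓜≥ : ℕ → ℕ → Set
𝓜≥ n t = Σ (Graph n) λ G → EdgeMagic G × m G ≥ t

{-# OPTIONS --safe #-}
module Submission where

open import Defs
open import Data.Nat using (ℕ; suc; _∸_; _≥_)
open import Data.Fin using (Fin; zero; fromℕ)
open import Data.Integer using (ℤ; +_; _+_; _-_; _≤_)
open import Data.Product using (Σ; _×_)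
open import Relation.Binary.PropositionalEquality using (_≡_; _≢_)

import Data.Nat as ℕ
import Data.Nat.Properties as ℕₚ
import Data.Fin as Fin
import Data.Fin.Properties as Finₚ
import Data.Integer as ℤ
import Data.Integer.Properties as ℤₚ
open import Algebra.Properties.AbelianGroup ℤₚ.+-0-abelianGroup using (//-rightDividesʳ; //-rightDividesˡ)
open import Data.Fin.Permutation using (Permutation′; _⟨$⟩ʳ_; insert; insert-punchIn)
import Data.Fin.Permutation as Permutation
open import Data.Product using (∃₂; _,_; proj₁; proj₂; uncurry)
open import Data.Sum using (_⊎_; inj₁; inj₂)
open import Data.Sum.Properties using (inj₂-injective)
open import Function using (_∘_)
open import Function.Bundles using (_⤖_; Bijection)
open import Function.Construct.Composition using (_↔-∘_)
open import Function.Construct.Symmetry using (↔-sym)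
open import Function.Definitions using (Injective)
open import Function.Properties.Inverse using (↔⇒⤖)
open import Relation.Binary.Definitions using (tri<; tri≈; tri>)
open import Relation.Binary.PropositionalEquality using (refl; sym; trans; cong; cong₂; subst; module ≡-Reasoning)
open import Relation.Nullary using (yes; no; contradiction)

-- Label the vertices by A itself: the n vertex labels are then distinct elements of [1, m], and the
-- remaining m − n labels of [1, m] go to edges.  The edge with label t joins a_i and a_j where
-- a_i + a_j = k + m − t, which lies in the window [k, k + m − 1] ⊆ A ⊕ A; so every edge has
-- weight k + m, and distinct edges, having distinct labels, have distinct endpoint sums and hence
-- distinct endpoints.

extendInjection : ∀ {N} E (f : Fin N → Fin (N ℕ.+ E)) → Injective _≡_ _≡_ f →
                  Σ (Permutation′ (N ℕ.+ E)) λ π → ∀ i → π ⟨$⟩ʳ (i Fin.↑ˡ E) ≡ f i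
extendInjection {ℕ.zero} E f f-injective = Permutation.id , λ ()
extendInjection {suc N} E f f-injective = insert zero (f zero) π , extends
  where
  f₀≢f : ∀ i → f zero ≢ f (Fin.suc i)
  f₀≢f i eq with () ← f-injective eq

  punched : Fin N → Fin (N ℕ.+ E)
  punched i = Fin.punchOut (f₀≢f i)

  punched-injective : Injective _≡_ _≡_ punched
  punched-injective {i} {j} eq =
    Finₚ.suc-injective (f-injective (Finₚ.punchOut-injective (f₀≢f i) (f₀≢f j) eq))

  extension : Σ (Permutation′ (N ℕ.+ E)) λ π → ∀ i → π ⟨$⟩ʳ (i Fin.↑ˡ E) ≡ punched i
  extension = extendInjection E punched punched-injective

  π : Permutation′ (N ℕ.+ E)
  π = proj₁ extension

  extends : ∀ i → insert zero (f zero) π ⟨$⟩ʳ (i Fin.↑ˡ E) ≡ f i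
  extends zero        = refl
  extends (Fin.suc i) = begin
    insert zero (f zero) π ⟨$⟩ʳ Fin.suc (i Fin.↑ˡ E)  ≡⟨ insert-punchIn zero (f zero) π (i Fin.↑ˡ E) ⟩
    Fin.punchIn (f zero) (π ⟨$⟩ʳ (i Fin.↑ˡ E))         ≡⟨ cong (Fin.punchIn (f zero)) (proj₂ extension i) ⟩
    Fin.punchIn (f zero) (punched i)                    ≡⟨ Finₚ.punchIn-punchOut (f₀≢f i) ⟩
    f (Fin.suc i)                                       ∎
    where open ≡-Reasoning

sortPair : ∀ {n} → Fin n → Fin n → Fin n × Fin n
sortPair i j with i Fin.<? j
... | yes _ = i , j
... | no  _ = j , i

sortPair-ordered : ∀ {n} {i j : Fin n} → i ≢ j → proj₁ (sortPair i j) Fin.< proj₂ (sortPair i j)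
sortPair-ordered {i = i} {j} i≢j with i Fin.<? j
... | yes i<j = i<j
... | no  i≮j = Finₚ.≤∧≢⇒< (ℕₚ.≮⇒≥ i≮j) (i≢j ∘ sym)

sortPair-sum : ∀ {n} (w : Fin n → ℕ) (i j : Fin n) →
               w (proj₁ (sortPair i j)) ℕ.+ w (proj₂ (sortPair i j)) ≡ w i ℕ.+ w j
sortPair-sum w i j with i Fin.<? j
... | yes _ = refl
... | no  _ = ℕₚ.+-comm (w j) (w i)

𝓜≥-fromVertexLabelling :
  ∀ {N m} (f : Fin N → Fin m) → Injective _≡_ _≡_ f → (s : ℕ) →
  (∀ t → t ℕ.< m → ∃₂ λ i j → i ≢ j × suc (Fin.toℕ (f i)) ℕ.+ suc (Fin.toℕ (f j)) ℕ.+ suc t ≡ s) →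
  𝓜≥ N (m ∸ N)
𝓜≥-fromVertexLabelling {N} {m} f f-injective s completions = G , (l , s , magic) , ℕₚ.≤-refl
  where
  E : ℕ
  E = m ∸ N

  N+E≡m : N ℕ.+ E ≡ m
  N+E≡m = ℕₚ.m+[n∸m]≡n (Finₚ.injective⇒≤ f-injective)

  weight : Fin N → ℕ
  weight i = suc (Fin.toℕ (f i))

  f′ : Fin N → Fin (N ℕ.+ E)
  f′ = Fin.cast (sym N+E≡m) ∘ f

  toℕ-f′ : ∀ i → Fin.toℕ (f′ i) ≡ Fin.toℕ (f i)
  toℕ-f′ i = Finₚ.toℕ-cast (sym N+E≡m) (f i)

  f′-injective : Injective _≡_ _≡_ f′
  f′-injective {i} {j} eq =
    f-injective (Finₚ.toℕ-injective (trans (sym (toℕ-f′ i)) (trans (cong Fin.toℕ eq) (toℕ-f′ j))))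

  extension : Σ (Permutation′ (N ℕ.+ E)) λ π → ∀ i → π ⟨$⟩ʳ (i Fin.↑ˡ E) ≡ f′ i
  extension = extendInjection E f′ f′-injective

  l : (Fin N ⊎ Fin E) ⤖ Fin (N ℕ.+ E)
  l = ↔⇒⤖ (proj₁ extension ↔-∘ ↔-sym Finₚ.+↔⊎)

  edgeLabel : Fin E → ℕ
  edgeLabel e = Fin.toℕ (Bijection.to l (inj₂ e))

  completion : ∀ e → ∃₂ λ i j → i ≢ j × weight i ℕ.+ weight j ℕ.+ suc (edgeLabel e) ≡ s
  completion e = completions (edgeLabel e) (subst (edgeLabel e ℕ.<_) N+E≡m (Finₚ.toℕ<n _))

  ends′ : Fin E → Fin N × Fin N
  ends′ e with i , j , _ ← completion e = sortPair i j

  ends′-ordered : ∀ e → Fin.toℕ (proj₁ (ends′ e)) ℕ.< Fin.toℕ (proj₂ (ends′ e))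
  ends′-ordered e with i , j , i≢j , _ ← completion e = sortPair-ordered i≢j

  endsWeight : Fin N × Fin N → ℕ
  endsWeight (i , j) = weight i ℕ.+ weight j

  edge-sum : ∀ e → endsWeight (ends′ e) ℕ.+ suc (edgeLabel e) ≡ s
  edge-sum e with i , j , _ , sum≡s ← completion e =
    trans (cong (ℕ._+ suc (edgeLabel e)) (sortPair-sum weight i j)) sum≡s

  sameEnds⇒sameLabel : ∀ {e e′} → ends′ e ≡ ends′ e′ → edgeLabel e ≡ edgeLabel e′
  sameEnds⇒sameLabel {e} {e′} eq =
    ℕₚ.suc-injective (ℕₚ.+-cancelˡ-≡ (endsWeight (ends′ e)) _ _ (begin
      endsWeight (ends′ e) ℕ.+ suc (edgeLabel e)    ≡⟨ edge-sum e ⟩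
      s                                             ≡⟨ edge-sum e′ ⟨
      endsWeight (ends′ e′) ℕ.+ suc (edgeLabel e′)  ≡⟨ cong (λ p → endsWeight p ℕ.+ suc (edgeLabel e′)) eq ⟨
      endsWeight (ends′ e) ℕ.+ suc (edgeLabel e′)   ∎))
    where open ≡-Reasoning

  ends′-injective : Injective _≡_ _≡_ ends′
  ends′-injective eq =
    inj₂-injective (Bijection.injective l (Finₚ.toℕ-injective (sameEnds⇒sameLabel eq)))

  G : Graph N
  G = record { m = E ; ends = ends′ ; ordered = ends′-ordered ; ends-inj = ends′-injective }

  label-inj₁≡weight : ∀ v → label G l (inj₁ v) ≡ weight v
  label-inj₁≡weight v = cong suc (trans (cong Fin.toℕ (proj₂ extension v)) (toℕ-f′ v))

  magic : ∀ e → label G l (inj₁ (proj₁ (ends′ e))) ℕ.+ label G l (inj₁ (proj₂ (ends′ e)))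
                  ℕ.+ label G l (inj₂ e) ≡ s
  magic e = trans (cong₂ (λ x y → x ℕ.+ y ℕ.+ suc (edgeLabel e)) (label-inj₁≡weight _) (label-inj₁≡weight _))
                  (edge-sum e)

strictlyIncreasing⇒injective : ∀ {n} {a : Fin n → ℤ} → (∀ i j → i Fin.< j → a i ℤ.< a j) →
                               Injective _≡_ _≡_ a
strictlyIncreasing⇒injective {a = a} a-increasing {i} {j} aᵢ≡aⱼ with Finₚ.<-cmp i j
... | tri< i<j _ _ = contradiction aᵢ≡aⱼ (ℤₚ.<⇒≢ (a-increasing i j i<j))
... | tri≈ _ i≡j _ = i≡j
... | tri> _ _ j<i = contradiction (sym aᵢ≡aⱼ) (ℤₚ.<⇒≢ (a-increasing j i j<i))

strictlyIncreasing⇒monotone : ∀ {n} {a : Fin n → ℤ} → (∀ i j → i Fin.< j → a i ℤ.< a j) →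
                              ∀ {i j} → i Fin.≤ j → a i ≤ a j
strictlyIncreasing⇒monotone a-increasing {i} {j} i≤j with i Finₚ.≟ j
... | yes refl = ℤₚ.≤-refl
... | no  i≢j  = ℤₚ.<⇒≤ (a-increasing i j (Finₚ.≤∧≢⇒< i≤j i≢j))

-- z ∈ [1, m] becomes z − 1 ∈ Fin m, the offset that `label` undoes.
toFin : ∀ {m} (z : ℤ) → + 1 ≤ z → z ≤ + m → Fin m
toFin (+ 0)     (ℤ.+≤+ ()) _
toFin (+ suc t) _          (ℤ.+≤+ t<m) = Fin.fromℕ< t<m

suc-toℕ-toFin : ∀ {m} z (1≤z : + 1 ≤ z) (z≤m : z ≤ + m) → + suc (Fin.toℕ (toFin z 1≤z z≤m)) ≡ z
suc-toℕ-toFin (+ 0)     (ℤ.+≤+ ()) _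
suc-toℕ-toFin (+ suc t) _          (ℤ.+≤+ t<m) = cong (λ u → + suc u) (Finₚ.toℕ-fromℕ< t<m)

window-point : ∀ k m {t} → t ℕ.< m → k ≤ k + + m - + suc t × k + + m - + suc t ≤ k + + m - + 1
window-point k m {t} t<m = lower , upper
  where
  lower : k ≤ k + + m - + suc t
  lower = begin
    k                        ≡⟨ sym (//-rightDividesʳ (+ suc t) k) ⟩
    k + + suc t - + suc t    ≤⟨ ℤₚ.+-monoˡ-≤ (ℤ.- + suc t) (ℤₚ.+-monoʳ-≤ k (ℤ.+≤+ t<m)) ⟩
    k + + m - + suc t        ∎
    where open ℤₚ.≤-Reasoning

  upper : k + + m - + suc t ≤ k + + m - + 1
  upper = ℤₚ.+-monoʳ-≤ (k + + m) (ℤₚ.neg-mono-≤ (ℤ.+≤+ (ℕ.s≤s ℕ.z≤n)))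

x+y+u≡∣c∣ : ∀ c x y u → + x + + y ≡ c - + u → x ℕ.+ y ℕ.+ u ≡ ℤ.∣ c ∣
x+y+u≡∣c∣ c x y u x+y≡c-u = cong ℤ.∣_∣ (begin
  + (x ℕ.+ y ℕ.+ u)     ≡⟨ ℤₚ.pos-+ (x ℕ.+ y) u ⟩
  + (x ℕ.+ y) + + u     ≡⟨ cong (_+ + u) (ℤₚ.pos-+ x y) ⟩
  + x + + y + + u       ≡⟨ cong (_+ + u) x+y≡c-u ⟩
  c - + u + + u         ≡⟨ //-rightDividesˡ (+ u) c ⟩
  c                     ∎)
  where open ≡-Reasoning

lemma3p1 : (n' : ℕ) (a : Fin (suc n') → ℤ) (k : ℤ) (m : ℕ) →
    a zero ≡ + 1 →
    (∀ i j → i Data.Fin.< j → a i Data.Integer.< a j) →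
    m ≥ 1 →
    (∀ z → k ≤ z → z ≤ k + + m - + 1 →
    Σ (Fin (suc n')) λ i → Σ (Fin (suc n')) λ j → i ≢ j × a i + a j ≡ z) →
    a (fromℕ n') ≤ + m →
    𝓜≥ (suc n') (m ∸ suc n')
lemma3p1 n' a k m a₀≡1 a-increasing _ window aₙ≤m =
  𝓜≥-fromVertexLabelling vertexLabel vertexLabel-injective ℤ.∣ k + + m ∣ completions
  where
  1≤a : ∀ i → + 1 ≤ a i
  1≤a i = subst (_≤ a i) a₀≡1 (strictlyIncreasing⇒monotone a-increasing ℕ.z≤n)

  a≤m : ∀ i → a i ≤ + m
  a≤m i = ℤₚ.≤-trans (strictlyIncreasing⇒monotone a-increasing (Finₚ.≤fromℕ i)) aₙ≤m

  vertexLabel : Fin (suc n') → Fin m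
  vertexLabel i = toFin (a i) (1≤a i) (a≤m i)

  weight : Fin (suc n') → ℕ
  weight i = suc (Fin.toℕ (vertexLabel i))

  weight≡a : ∀ i → + weight i ≡ a i
  weight≡a i = suc-toℕ-toFin (a i) (1≤a i) (a≤m i)

  vertexLabel-injective : Injective _≡_ _≡_ vertexLabel
  vertexLabel-injective {i} {j} eq = strictlyIncreasing⇒injective a-increasing
    (trans (sym (weight≡a i)) (trans (cong (λ x → + suc (Fin.toℕ x)) eq) (weight≡a j)))

  completions : ∀ t → t ℕ.< m → ∃₂ λ i j → i ≢ j ×
                weight i ℕ.+ weight j ℕ.+ suc t ≡ ℤ.∣ k + + m ∣
  completions t t<m with i , j , i≢j , aᵢ+aⱼ≡z ← uncurry (window _) (window-point k m t<m) =
    i , j , i≢j , x+y+u≡∣c∣ (k + + m) (weight i) (weight j) (suc t)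
                    (trans (cong₂ _+_ (weight≡a i) (weight≡a j)) aᵢ+aⱼ≡z)
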